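{- Up to cyclic permutation, the irreducible solutions of $(E_7)$ (entries in $\mathbb{Z}/7\mathbb{Z}$) are exactly the following: size 3: $(1,1,1)$, $(-1,-1,-1)$; size 4: $(3,3,3,3)$, $(4,4,4,4)$, $(5,0,2,0)$, $(4,0,3,0)$, $(0,0,0,0)$; size 5: $(2,2,5,4,5)$, $(5,5,2,3,2)$; size 6: $(2,2,2,4,3,4)$, $(5,5,5,3,4,3)$, $(2,3,4,5,4,3)$, $(2,3,5,2,5,3)$, $(5,4,2,5,2,4)$, $(2,3,5,3,2,4)$, $(5,4,2,4,5,3)$, $(2,4,2,4,2,4)$, $(5,3,5,3,5,3)$, $(2,5,2,5,2,5)$; size 7: $(2,2,2,2,2,2,2)$, $(5,5,5,5,5,5,5)$, $(2,2,2,3,5,5,3)$, $(5,5,5,4,2,2,4)$, $(2,2,3,4,2,4,3)$, $(5,5,4,3,5,3,4)$; size 8: $(2,2,3,4,3,2,2,4)$, $(5,5,4,3,4,5,5,3)$, $(2,3,4,3,4,5,3,4)$, $(5,4,3,4,3,2,4,3)$, $(2,4,3,5,2,4,3,5)$, $(5,3,4,2,5,3,4,2)$, $(3,4,3,4,3,4,3,4)$; size 9: $(2,2,2,2,3,4,3,4,3)$, $(5,5,5,5,4,3,4,3,4)$, $(2,2,3,5,4,3,4,5,3)$, $(5,5,4,2,3,4,3,2,4)$, $(2,2,3,5,4,3,5,2,4)$, $(5,5,4,2,3,4,2,5,3)$, $(2,2,4,2,2,4,2,2,4)$, $(5,5,3,5,5,3,5,5,3)$, $(2,2,4,2,5,3,4,5,3)$,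 $(5,5,3,5,2,4,3,2,4)$, $(2,2,4,2,5,3,5,2,4)$, $(5,5,3,5,2,4,2,5,3)$, $(2,3,4,2,3,4,2,3,4)$, $(5,4,3,5,4,3,5,4,3)$, $(2,4,3,2,4,3,2,4,3)$, $(5,3,4,5,3,4,5,3,4)$. In particular $(E_7)$ has no irreducible solution of size $\ge 10$.
   Context: For $a_1,\dots,a_n\in\mathbb{Z}/N\mathbb{Z}$ set $M_n(a_1,\dots,a_n)=\begin{pmatrix}a_n&-1\\1&0\end{pmatrix}\cdots\begin{pmatrix}a_1&-1\\1&0\end{pmatrix}$. An $n$-tuple is a solution of $(E_N)$ (of size $n$) if $M_n(a_1,\dots,a_n)=\pm\mathrm{Id}$ over $\mathbb{Z}/N\mathbb{Z}$; here $N=7$. The sum of $(a_1,\dots,a_n)$ and $(b_1,\dots,b_m)$ is $(a_1+b_m,a_2,\dots,a_{n-1},a_n+b_1,b_2,\dots,b_{m-1})$. Two $n$-tuples are equivalent ($\sim$) if one is a cyclic permutation of the other or of its reversal. A solution $(c_1,\dots,c_n)$ with $n\ge3$ is reducible if there exist solutions $(a_1,\dots,a_m)$, $(b_1,\dots,b_l)$ with $m,l\ge3$ and $(c_1,\dots,c_n)\sim(a_1,\dots,a_m)\oplus(b_1,\dots,b_l)$; a solution of size $\ge3$ is irreducible if it is not reducible. -}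

module Defs where

open import Data.Nat using (ℕ; zero; suc; _∸_; _≤_; _<_)
import Data.Nat as ℕ
open import Data.Nat.DivMod using (_mod_)
open import Data.Fin using (Fin; toℕ)
open import Data.List using (List; []; _∷_; _++_; [_]; length; foldl; reverse; drop; take; map)
open import Data.Product using (Σ; ∃; _×_; _,_)
open import Data.Sum using (_⊎_)
open import Relation.Nullary using (¬_)
open import Relation.Binary.PropositionalEquality using (_≡_)

Z7 : Set
Z7 = Fin 7

_+₇_ : Z7 → Z7 → Z7
a +₇ b = (toℕ a ℕ.+ toℕ b) mod 7

_*₇_ : Z7 → Z7 → Z7
a *₇ b = (toℕ a ℕ.* toℕ b) mod 7

-₇_ : Z7 → Z7
-₇ a = (7 ∸ toℕ a) mod 7

0₇ 1₇ : Z7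
0₇ = 0 mod 7
1₇ = 1 mod 7

record Mat : Set where
  constructor mat
  field
    m11 m12 m21 m22 : Z7

_⊗_ : Mat → Mat → Mat
mat a b c d ⊗ mat e f g h =
  mat ((a *₇ e) +₇ (b *₇ g)) ((a *₇ f) +₇ (b *₇ h))
      ((c *₇ e) +₇ (d *₇ g)) ((c *₇ f) +₇ (d *₇ h))

Id : Mat
Id = mat 1₇ 0₇ 0₇ 1₇

-Id : Mat
-Id = mat (-₇ 1₇) 0₇ 0₇ (-₇ 1₇)

Mᵃ : Z7 → Mat
Mᵃ a = mat a (-₇ 1₇) 1₇ 0₇

-- M_n(a_1,…,a_n) = M(a_n) ⋯ M(a_1)
Mn : List Z7 → Mat
Mn = foldl (λ acc a → Mᵃ a ⊗ acc) Id

IsSolution : List Z7 → Set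
IsSolution c = Mn c ≡ Id ⊎ Mn c ≡ -Id

rotate : ℕ → List Z7 → List Z7
rotate k xs = drop k xs ++ take k xs

IsCyclicPerm : List Z7 → List Z7 → Set
IsCyclicPerm c d = ∃ λ k → c ≡ rotate k d

_∼_ : List Z7 → List Z7 → Set
c ∼ d = IsCyclicPerm c d ⊎ IsCyclicPerm c (reverse d)

⊕ : Z7 → List Z7 → Z7 → Z7 → List Z7 → Z7 → List Z7
⊕ a₁ amid aₘ b₁ bmid bₗ = (a₁ +₇ bₗ) ∷ amid ++ [ aₘ +₇ b₁ ] ++ bmid

tup : Z7 → List Z7 → Z7 → List Z7
tup x mid y = x ∷ mid ++ [ y ]

-- reducible: c ∼ a ⊕ b with a, b solutions of size ≥ 3
-- (size of tup x mid y is length mid + 2, so size ≥ 3 iff length mid ≥ 1)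
Reducible : List Z7 → Set
Reducible c =
  Σ Z7 λ a₁ → Σ (List Z7) λ amid → Σ Z7 λ aₘ →
  Σ Z7 λ b₁ → Σ (List Z7) λ bmid → Σ Z7 λ bₗ →
    IsSolution (tup a₁ amid aₘ) × 1 ≤ length amid ×
    IsSolution (tup b₁ bmid bₗ) × 1 ≤ length bmid ×
    c ∼ ⊕ a₁ amid aₘ b₁ bmid bₗ

Irreducible : List Z7 → Set
Irreducible c = IsSolution c × 3 ≤ length c × ¬ Reducible c

-- the list from the paper (entries given as naturals, reduced mod 7; -1 = 6)
toZ7 : List ℕ → List Z7
toZ7 = map (λ x → x mod 7)

table : List (List ℕ)
table =
  (1 ∷ 1 ∷ 1 ∷ []) ∷ (6 ∷ 6 ∷ 6 ∷ []) ∷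
  (3 ∷ 3 ∷ 3 ∷ 3 ∷ []) ∷ (4 ∷ 4 ∷ 4 ∷ 4 ∷ []) ∷ (5 ∷ 0 ∷ 2 ∷ 0 ∷ []) ∷
  (4 ∷ 0 ∷ 3 ∷ 0 ∷ []) ∷ (0 ∷ 0 ∷ 0 ∷ 0 ∷ []) ∷
  (2 ∷ 2 ∷ 5 ∷ 4 ∷ 5 ∷ []) ∷ (5 ∷ 5 ∷ 2 ∷ 3 ∷ 2 ∷ []) ∷
  (2 ∷ 2 ∷ 2 ∷ 4 ∷ 3 ∷ 4 ∷ []) ∷ (5 ∷ 5 ∷ 5 ∷ 3 ∷ 4 ∷ 3 ∷ []) ∷
  (2 ∷ 3 ∷ 4 ∷ 5 ∷ 4 ∷ 3 ∷ []) ∷ (2 ∷ 3 ∷ 5 ∷ 2 ∷ 5 ∷ 3 ∷ []) ∷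
  (5 ∷ 4 ∷ 2 ∷ 5 ∷ 2 ∷ 4 ∷ []) ∷ (2 ∷ 3 ∷ 5 ∷ 3 ∷ 2 ∷ 4 ∷ []) ∷
  (5 ∷ 4 ∷ 2 ∷ 4 ∷ 5 ∷ 3 ∷ []) ∷ (2 ∷ 4 ∷ 2 ∷ 4 ∷ 2 ∷ 4 ∷ []) ∷
  (5 ∷ 3 ∷ 5 ∷ 3 ∷ 5 ∷ 3 ∷ []) ∷ (2 ∷ 5 ∷ 2 ∷ 5 ∷ 2 ∷ 5 ∷ []) ∷
  (2 ∷ 2 ∷ 2 ∷ 2 ∷ 2 ∷ 2 ∷ 2 ∷ []) ∷ (5 ∷ 5 ∷ 5 ∷ 5 ∷ 5 ∷ 5 ∷ 5 ∷ []) ∷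
  (2 ∷ 2 ∷ 2 ∷ 3 ∷ 5 ∷ 5 ∷ 3 ∷ []) ∷ (5 ∷ 5 ∷ 5 ∷ 4 ∷ 2 ∷ 2 ∷ 4 ∷ []) ∷
  (2 ∷ 2 ∷ 3 ∷ 4 ∷ 2 ∷ 4 ∷ 3 ∷ []) ∷ (5 ∷ 5 ∷ 4 ∷ 3 ∷ 5 ∷ 3 ∷ 4 ∷ []) ∷
  (2 ∷ 2 ∷ 3 ∷ 4 ∷ 3 ∷ 2 ∷ 2 ∷ 4 ∷ []) ∷ (5 ∷ 5 ∷ 4 ∷ 3 ∷ 4 ∷ 5 ∷ 5 ∷ 3 ∷ []) ∷
  (2 ∷ 3 ∷ 4 ∷ 3 ∷ 4 ∷ 5 ∷ 3 ∷ 4 ∷ []) ∷ (5 ∷ 4 ∷ 3 ∷ 4 ∷ 3 ∷ 2 ∷ 4 ∷ 3 ∷ []) ∷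
  (2 ∷ 4 ∷ 3 ∷ 5 ∷ 2 ∷ 4 ∷ 3 ∷ 5 ∷ []) ∷ (5 ∷ 3 ∷ 4 ∷ 2 ∷ 5 ∷ 3 ∷ 4 ∷ 2 ∷ []) ∷
  (3 ∷ 4 ∷ 3 ∷ 4 ∷ 3 ∷ 4 ∷ 3 ∷ 4 ∷ []) ∷
  (2 ∷ 2 ∷ 2 ∷ 2 ∷ 3 ∷ 4 ∷ 3 ∷ 4 ∷ 3 ∷ []) ∷ (5 ∷ 5 ∷ 5 ∷ 5 ∷ 4 ∷ 3 ∷ 4 ∷ 3 ∷ 4 ∷ []) ∷
  (2 ∷ 2 ∷ 3 ∷ 5 ∷ 4 ∷ 3 ∷ 4 ∷ 5 ∷ 3 ∷ []) ∷ (5 ∷ 5 ∷ 4 ∷ 2 ∷ 3 ∷ 4 ∷ 3 ∷ 2 ∷ 4 ∷ []) ∷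
  (2 ∷ 2 ∷ 3 ∷ 5 ∷ 4 ∷ 3 ∷ 5 ∷ 2 ∷ 4 ∷ []) ∷ (5 ∷ 5 ∷ 4 ∷ 2 ∷ 3 ∷ 4 ∷ 2 ∷ 5 ∷ 3 ∷ []) ∷
  (2 ∷ 2 ∷ 4 ∷ 2 ∷ 2 ∷ 4 ∷ 2 ∷ 2 ∷ 4 ∷ []) ∷ (5 ∷ 5 ∷ 3 ∷ 5 ∷ 5 ∷ 3 ∷ 5 ∷ 5 ∷ 3 ∷ []) ∷
  (2 ∷ 2 ∷ 4 ∷ 2 ∷ 5 ∷ 3 ∷ 4 ∷ 5 ∷ 3 ∷ []) ∷ (5 ∷ 5 ∷ 3 ∷ 5 ∷ 2 ∷ 4 ∷ 3 ∷ 2 ∷ 4 ∷ []) ∷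
  (2 ∷ 2 ∷ 4 ∷ 2 ∷ 5 ∷ 3 ∷ 5 ∷ 2 ∷ 4 ∷ []) ∷ (5 ∷ 5 ∷ 3 ∷ 5 ∷ 2 ∷ 4 ∷ 2 ∷ 5 ∷ 3 ∷ []) ∷
  (2 ∷ 3 ∷ 4 ∷ 2 ∷ 3 ∷ 4 ∷ 2 ∷ 3 ∷ 4 ∷ []) ∷ (5 ∷ 4 ∷ 3 ∷ 5 ∷ 4 ∷ 3 ∷ 5 ∷ 4 ∷ 3 ∷ []) ∷
  (2 ∷ 4 ∷ 3 ∷ 2 ∷ 4 ∷ 3 ∷ 2 ∷ 4 ∷ 3 ∷ []) ∷ (5 ∷ 3 ∷ 4 ∷ 5 ∷ 3 ∷ 4 ∷ 5 ∷ 3 ∷ 4 ∷ []) ∷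
  []

-- Every M(a) has determinant 1, so a window w of consecutive entries can be completed to a
-- solution (b₁, w, bₗ) exactly when the (1,1) entry of Mₙ(w) is ±1.  Splitting an entry x + y
-- into (x, 0, y) only changes the sign of Mₙ, and solutions are closed under rotation; hence
-- if some rotation of a solution c reads r ++ w with |r| ≥ 3 and w completable to b, then c is
-- the sum of b and a complementary solution.  So irreducibility of c amounts to a condition
-- on finitely many windows of the rotations and reflections of c.  Building words by
-- prepending entries while no window of length ≤ n − 3 is completable, no word of length 8
-- survives for windows of length ≤ 7, which bounds the size by 9; for sizes 3 to 9 the
-- surviving solutions are the listed ones, and each listed word passes the window check.
module Submission where

open import Defs
open import Data.Nat using (ℕ; zero; suc; _+_; _∸_; _≤_; _<_; _≤?_; z≤n; s≤s)
open import Data.Nat.Properties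
  using (≤-trans; ≤-reflexive; <⇒≤; ≰⇒>; +-comm; +-cancelˡ-≤; +-monoʳ-≤; +-monoˡ-≤;
         m≤m+n; m<m+n; m∸n≤m; m⊓n≤m; m∸n+n≡m; m∸[m∸n]≡n)
open import Data.Fin using (Fin; zero; toℕ; fromℕ<)
open import Data.Fin.Properties using (_≟_; all?; any?; toℕ<n; toℕ-fromℕ<)
open import Data.List
  using (List; []; _∷_; _++_; [_]; _∷ʳ_; length; take; drop; reverse; foldl; map; filter;
         concatMap; allFin; initLast; _∷ʳ′_)
open import Data.List.Properties
  using (≡-dec; ++-assoc; ++-identityʳ; foldl-++; length-++; length-++-comm; length-drop; length-take;
         take++drop≡id; take-all; drop-all; reverse-involutive)
open import Data.List.Membership.Propositional using (_∈_; find)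
open import Data.List.Membership.Propositional.Properties using (∈-concatMap⁺; ∈-filter⁺; ∈-map⁺; ∈-allFin)
open import Data.List.Relation.Unary.All using (All)
import Data.List.Relation.Unary.All as All
open import Data.List.Relation.Unary.Any using (Any; here)
import Data.List.Relation.Unary.Any as Any
open import Data.List.Relation.Unary.Any.Properties using (¬Any[])
open import Data.Product using (∃; ∃₂; _×_; _,_; proj₁; proj₂)
open import Data.Sum using (_⊎_; inj₁; inj₂)
open import Data.Unit using (⊤; tt)
open import Data.Empty using (⊥-elim)
open import Function.Bundles using (_⇔_; mk⇔)
open import Relation.Nullary using (¬_; Dec; yes; no)
open import Relation.Nullary.Decidable using (_×-dec_; _⊎-dec_; _→-dec_; ¬?; map′; from-yes)
open import Relation.Unary using (Decidable)
open import Relation.Binary.PropositionalEquality hiding ([_])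
open ≡-Reasoning

+₇-comm : ∀ a b → a +₇ b ≡ b +₇ a
+₇-comm = from-yes (all? λ a → all? λ b → (a +₇ b) ≟ (b +₇ a))

+₇-interchange : ∀ a b c d → (a +₇ b) +₇ (c +₇ d) ≡ (a +₇ c) +₇ (b +₇ d)
+₇-interchange = from-yes (all? λ a → all? λ b → all? λ c → all? λ d →
  ((a +₇ b) +₇ (c +₇ d)) ≟ ((a +₇ c) +₇ (b +₇ d)))

*₇-assoc : ∀ a b c → (a *₇ b) *₇ c ≡ a *₇ (b *₇ c)
*₇-assoc = from-yes (all? λ a → all? λ b → all? λ c → ((a *₇ b) *₇ c) ≟ (a *₇ (b *₇ c)))

*₇-distribˡ-+₇ : ∀ a b c → a *₇ (b +₇ c) ≡ (a *₇ b) +₇ (a *₇ c)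
*₇-distribˡ-+₇ = from-yes (all? λ a → all? λ b → all? λ c → (a *₇ (b +₇ c)) ≟ ((a *₇ b) +₇ (a *₇ c)))

*₇-distribʳ-+₇ : ∀ a b c → (b +₇ c) *₇ a ≡ (b *₇ a) +₇ (c *₇ a)
*₇-distribʳ-+₇ = from-yes (all? λ a → all? λ b → all? λ c → ((b +₇ c) *₇ a) ≟ ((b *₇ a) +₇ (c *₇ a)))

x-y+y≡x : ∀ x y → (x +₇ (-₇ y)) +₇ y ≡ x
x-y+y≡x = from-yes (all? λ x → all? λ y → ((x +₇ (-₇ y)) +₇ y) ≟ x)

mat-cong : ∀ {a b c d a′ b′ c′ d′} → a ≡ a′ → b ≡ b′ → c ≡ c′ → d ≡ d′ → mat a b c d ≡ mat a′ b′ c′ d′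
mat-cong refl refl refl refl = refl

_≟ᴹ_ : (X Y : Mat) → Dec (X ≡ Y)
mat a b c d ≟ᴹ mat e f g h =
  map′ (λ { (refl , refl , refl , refl) → refl }) (λ { refl → refl , refl , refl , refl })
       ((a ≟ e) ×-dec (b ≟ f) ×-dec (c ≟ g) ×-dec (d ≟ h))

all-mat? : ∀ {p} {P : Mat → Set p} → Decidable P → Dec (∀ X → P X)
all-mat? P? =
  map′ (λ h X → h (Mat.m11 X) (Mat.m12 X) (Mat.m21 X) (Mat.m22 X)) (λ h a b c d → h (mat a b c d))
       (all? λ a → all? λ b → all? λ c → all? λ d → P? (mat a b c d))

⊗-assoc : ∀ X Y Z → (X ⊗ Y) ⊗ Z ≡ X ⊗ (Y ⊗ Z)
⊗-assoc (mat a b c d) (mat e f g h) (mat i j k l) =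
  mat-cong (entry a b e f g h i k) (entry a b e f g h j l) (entry c d e f g h i k) (entry c d e f g h j l)
  where
  entry : ∀ a b e f g h i k →
    (((a *₇ e) +₇ (b *₇ g)) *₇ i) +₇ (((a *₇ f) +₇ (b *₇ h)) *₇ k)
    ≡ (a *₇ ((e *₇ i) +₇ (f *₇ k))) +₇ (b *₇ ((g *₇ i) +₇ (h *₇ k)))
  entry a b e f g h i k = begin
    (((a *₇ e) +₇ (b *₇ g)) *₇ i) +₇ (((a *₇ f) +₇ (b *₇ h)) *₇ k)
      ≡⟨ cong₂ _+₇_ (*₇-distribʳ-+₇ i (a *₇ e) (b *₇ g)) (*₇-distribʳ-+₇ k (a *₇ f) (b *₇ h)) ⟩
    (((a *₇ e) *₇ i) +₇ ((b *₇ g) *₇ i)) +₇ (((a *₇ f) *₇ k) +₇ ((b *₇ h) *₇ k))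
      ≡⟨ cong₂ _+₇_ (cong₂ _+₇_ (*₇-assoc a e i) (*₇-assoc b g i)) (cong₂ _+₇_ (*₇-assoc a f k) (*₇-assoc b h k)) ⟩
    ((a *₇ (e *₇ i)) +₇ (b *₇ (g *₇ i))) +₇ ((a *₇ (f *₇ k)) +₇ (b *₇ (h *₇ k)))
      ≡⟨ +₇-interchange (a *₇ (e *₇ i)) (b *₇ (g *₇ i)) (a *₇ (f *₇ k)) (b *₇ (h *₇ k)) ⟩
    ((a *₇ (e *₇ i)) +₇ (a *₇ (f *₇ k))) +₇ ((b *₇ (g *₇ i)) +₇ (b *₇ (h *₇ k)))
      ≡⟨ sym (cong₂ _+₇_ (*₇-distribˡ-+₇ a (e *₇ i) (f *₇ k)) (*₇-distribˡ-+₇ b (g *₇ i) (h *₇ k))) ⟩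
    (a *₇ ((e *₇ i) +₇ (f *₇ k))) +₇ (b *₇ ((g *₇ i) +₇ (h *₇ k))) ∎

⊗-identityˡ : ∀ X → Id ⊗ X ≡ X
⊗-identityˡ = from-yes (all-mat? λ X → (Id ⊗ X) ≟ᴹ X)

⊗-identityʳ : ∀ X → X ⊗ Id ≡ X
⊗-identityʳ = from-yes (all-mat? λ X → (X ⊗ Id) ≟ᴹ X)

-Id-central : ∀ X → -Id ⊗ X ≡ X ⊗ -Id
-Id-central = from-yes (all-mat? λ X → (-Id ⊗ X) ≟ᴹ (X ⊗ -Id))

Mᵃ⁻¹ : Z7 → Mat
Mᵃ⁻¹ a = mat 0₇ 1₇ (-₇ 1₇) a

Mᵃ-inverseʳ : ∀ a → Mᵃ a ⊗ Mᵃ⁻¹ a ≡ Id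
Mᵃ-inverseʳ = from-yes (all? λ a → (Mᵃ a ⊗ Mᵃ⁻¹ a) ≟ᴹ Id)

det : Mat → Z7
det (mat a b c d) = (a *₇ d) +₇ (-₇ (b *₇ c))

det-⊗-Mᵃ : ∀ P x → det (P ⊗ Mᵃ x) ≡ det P
det-⊗-Mᵃ = from-yes (all-mat? λ P → all? λ x → det (P ⊗ Mᵃ x) ≟ det P)

Is±Id : Mat → Set
Is±Id X = X ≡ Id ⊎ X ≡ -Id

is±Id? : Decidable Is±Id
is±Id? X = (X ≟ᴹ Id) ⊎-dec (X ≟ᴹ -Id)

Is±Id-central : ∀ {S} → Is±Id S → ∀ X → S ⊗ X ≡ X ⊗ S
Is±Id-central (inj₁ refl) X = trans (⊗-identityˡ X) (sym (⊗-identityʳ X))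
Is±Id-central (inj₂ refl) X = -Id-central X

Is±Id-⊗ : ∀ {S T} → Is±Id S → Is±Id T → Is±Id (S ⊗ T)
Is±Id-⊗ (inj₁ refl) (inj₁ refl) = inj₁ refl
Is±Id-⊗ (inj₁ refl) (inj₂ refl) = inj₂ refl
Is±Id-⊗ (inj₂ refl) (inj₁ refl) = inj₂ refl
Is±Id-⊗ (inj₂ refl) (inj₂ refl) = inj₁ refl

Is±Id-square : ∀ {S} → Is±Id S → S ⊗ S ≡ Id
Is±Id-square (inj₁ refl) = refl
Is±Id-square (inj₂ refl) = refl

Is±Id-cancelʳ : ∀ {X T} → Is±Id T → Is±Id (X ⊗ T) → Is±Id X
Is±Id-cancelʳ {X} {T} t xt = subst Is±Id X⊗T⊗T≡X (Is±Id-⊗ xt t)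
  where
  X⊗T⊗T≡X : (X ⊗ T) ⊗ T ≡ X
  X⊗T⊗T≡X = trans (⊗-assoc X T T) (trans (cong (X ⊗_) (Is±Id-square t)) (⊗-identityʳ X))

Is±Id-swap : ∀ {X Y Y′} → Y ⊗ Y′ ≡ Id → Is±Id (X ⊗ Y) → Is±Id (Y ⊗ X)
Is±Id-swap {X} {Y} {Y′} inverse s = subst Is±Id (sym Y⊗X≡X⊗Y) s
  where
  Y⊗X≡X⊗Y : Y ⊗ X ≡ X ⊗ Y
  Y⊗X≡X⊗Y = begin
    Y ⊗ X                  ≡⟨ sym (⊗-identityʳ (Y ⊗ X)) ⟩
    (Y ⊗ X) ⊗ Id           ≡⟨ cong ((Y ⊗ X) ⊗_) (sym inverse) ⟩
    (Y ⊗ X) ⊗ (Y ⊗ Y′)     ≡⟨ ⊗-assoc Y X (Y ⊗ Y′) ⟩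
    Y ⊗ (X ⊗ (Y ⊗ Y′))     ≡⟨ cong (Y ⊗_) (sym (⊗-assoc X Y Y′)) ⟩
    Y ⊗ ((X ⊗ Y) ⊗ Y′)     ≡⟨ cong (Y ⊗_) (Is±Id-central s Y′) ⟩
    Y ⊗ (Y′ ⊗ (X ⊗ Y))     ≡⟨ sym (⊗-assoc Y Y′ (X ⊗ Y)) ⟩
    (Y ⊗ Y′) ⊗ (X ⊗ Y)     ≡⟨ cong (_⊗ (X ⊗ Y)) inverse ⟩
    Id ⊗ (X ⊗ Y)           ≡⟨ ⊗-identityˡ (X ⊗ Y) ⟩
    X ⊗ Y                  ∎

Mn-foldl : ∀ xs A → foldl (λ acc a → Mᵃ a ⊗ acc) A xs ≡ Mn xs ⊗ A
Mn-foldl [] A = sym (⊗-identityˡ A)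
Mn-foldl (x ∷ xs) A = begin
  foldl (λ acc a → Mᵃ a ⊗ acc) (Mᵃ x ⊗ A) xs ≡⟨ Mn-foldl xs (Mᵃ x ⊗ A) ⟩
  Mn xs ⊗ (Mᵃ x ⊗ A)                        ≡⟨ cong (λ M → Mn xs ⊗ (M ⊗ A)) (sym (⊗-identityʳ (Mᵃ x))) ⟩
  Mn xs ⊗ ((Mᵃ x ⊗ Id) ⊗ A)                 ≡⟨ sym (⊗-assoc (Mn xs) (Mᵃ x ⊗ Id) A) ⟩
  (Mn xs ⊗ (Mᵃ x ⊗ Id)) ⊗ A                 ≡⟨ cong (_⊗ A) (sym (Mn-foldl xs (Mᵃ x ⊗ Id))) ⟩
  Mn (x ∷ xs) ⊗ A                           ∎

Mn-++ : ∀ xs ys → Mn (xs ++ ys) ≡ Mn ys ⊗ Mn xs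
Mn-++ xs ys = trans (foldl-++ (λ acc a → Mᵃ a ⊗ acc) Id xs ys) (Mn-foldl ys (Mn xs))

Mn-∷ : ∀ x xs → Mn (x ∷ xs) ≡ Mn xs ⊗ Mᵃ x
Mn-∷ x xs = trans (Mn-++ [ x ] xs) (cong (Mn xs ⊗_) (⊗-identityʳ (Mᵃ x)))

Mn-tup : ∀ b₁ w bₗ → Mn (tup b₁ w bₗ) ≡ Mᵃ bₗ ⊗ (Mn w ⊗ Mᵃ b₁)
Mn-tup b₁ w bₗ = begin
  Mn (b₁ ∷ w ++ [ bₗ ])        ≡⟨ Mn-∷ b₁ (w ++ [ bₗ ]) ⟩
  Mn (w ++ [ bₗ ]) ⊗ Mᵃ b₁     ≡⟨ cong (_⊗ Mᵃ b₁) (Mn-++ w [ bₗ ]) ⟩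
  (Mn [ bₗ ] ⊗ Mn w) ⊗ Mᵃ b₁   ≡⟨ cong (λ M → (M ⊗ Mn w) ⊗ Mᵃ b₁) (⊗-identityʳ (Mᵃ bₗ)) ⟩
  (Mᵃ bₗ ⊗ Mn w) ⊗ Mᵃ b₁       ≡⟨ ⊗-assoc (Mᵃ bₗ) (Mn w) (Mᵃ b₁) ⟩
  Mᵃ bₗ ⊗ (Mn w ⊗ Mᵃ b₁)       ∎

Mn-insert-0 : ∀ x y → Mn (y ∷ 0₇ ∷ [ x ]) ≡ -Id ⊗ Mn [ x +₇ y ]
Mn-insert-0 = from-yes (all? λ x → all? λ y → Mn (y ∷ 0₇ ∷ [ x ]) ≟ᴹ (-Id ⊗ Mn [ x +₇ y ]))

det-Mn : ∀ w → det (Mn w) ≡ 1₇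
det-Mn [] = refl
det-Mn (x ∷ w) = begin
  det (Mn (x ∷ w))    ≡⟨ cong det (Mn-∷ x w) ⟩
  det (Mn w ⊗ Mᵃ x)   ≡⟨ det-⊗-Mᵃ (Mn w) x ⟩
  det (Mn w)          ≡⟨ det-Mn w ⟩
  1₇                  ∎

IsSolution-rotate : ∀ xs ys → IsSolution (xs ++ ys) → IsSolution (ys ++ xs)
IsSolution-rotate [] ys sol = subst IsSolution (sym (++-identityʳ ys)) sol
IsSolution-rotate (x ∷ xs) ys sol =
  subst IsSolution (++-assoc ys [ x ] xs)
    (IsSolution-rotate xs (ys ++ [ x ]) (subst IsSolution (++-assoc xs ys [ x ]) rotated-once))
  where
  rotated-once : IsSolution ((xs ++ ys) ++ [ x ])
  rotated-once =
    subst Is±Id (sym (Mn-++ (xs ++ ys) [ x ]))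
      (Is±Id-swap {Mn (xs ++ ys)} {Mn [ x ]} {Mᵃ⁻¹ x}
        (trans (cong (_⊗ Mᵃ⁻¹ x) (⊗-identityʳ (Mᵃ x))) (Mᵃ-inverseʳ x))
        (subst Is±Id (Mn-++ [ x ] (xs ++ ys)) sol))

IsSolution-replaceˡ : ∀ m m′ ys → Mn m′ ≡ -Id ⊗ Mn m → IsSolution (m ++ ys) → IsSolution (m′ ++ ys)
IsSolution-replaceˡ m m′ ys m′≡-m sol =
  subst Is±Id (sym Mn[m′++ys]) (Is±Id-⊗ (inj₂ refl) (subst Is±Id (Mn-++ m ys) sol))
  where
  Mn[m′++ys] : Mn (m′ ++ ys) ≡ -Id ⊗ (Mn ys ⊗ Mn m)
  Mn[m′++ys] = begin
    Mn (m′ ++ ys)              ≡⟨ Mn-++ m′ ys ⟩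
    Mn ys ⊗ Mn m′              ≡⟨ cong (Mn ys ⊗_) m′≡-m ⟩
    Mn ys ⊗ (-Id ⊗ Mn m)       ≡⟨ sym (⊗-assoc (Mn ys) -Id (Mn m)) ⟩
    (Mn ys ⊗ -Id) ⊗ Mn m       ≡⟨ cong (_⊗ Mn m) (sym (-Id-central (Mn ys))) ⟩
    (-Id ⊗ Mn ys) ⊗ Mn m       ≡⟨ ⊗-assoc -Id (Mn ys) (Mn m) ⟩
    -Id ⊗ (Mn ys ⊗ Mn m)       ∎

IsSolution-cancelˡ : ∀ xs ys → IsSolution (xs ++ ys) → IsSolution xs → IsSolution ys
IsSolution-cancelˡ xs ys sol solₓ = Is±Id-cancelʳ {Mn ys} {Mn xs} solₓ (subst Is±Id (Mn-++ xs ys) sol)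

-- Cyclically, a ⊕ b reads (a₁ + bₗ) amid (aₘ + b₁) bmid.  Splitting both sums by a 0 and
-- rotating gives b followed by (0, a, 0), and (0, 0) contributes the scalar -Id.
IsSolution-⊕-cancelʳ : ∀ a₁ amid aₘ b₁ bmid bₗ →
  IsSolution (⊕ a₁ amid aₘ b₁ bmid bₗ) → IsSolution (tup b₁ bmid bₗ) → IsSolution (tup a₁ amid aₘ)
IsSolution-⊕-cancelʳ a₁ amid aₘ b₁ bmid bₗ sum b =
  IsSolution-replaceˡ (0₇ ∷ [ 0₇ ]) [] (tup a₁ amid aₘ) refl
    (IsSolution-rotate (0₇ ∷ tup a₁ amid aₘ) [ 0₇ ] 0-a-0)
  where
  first-split : IsSolution (bₗ ∷ 0₇ ∷ a₁ ∷ amid ++ (aₘ +₇ b₁) ∷ bmid)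
  first-split =
    IsSolution-replaceˡ [ a₁ +₇ bₗ ] (bₗ ∷ 0₇ ∷ [ a₁ ]) (amid ++ (aₘ +₇ b₁) ∷ bmid) (Mn-insert-0 a₁ bₗ) sum

  second-split : IsSolution (aₘ ∷ 0₇ ∷ b₁ ∷ bmid ++ bₗ ∷ 0₇ ∷ a₁ ∷ amid)
  second-split =
    IsSolution-replaceˡ [ aₘ +₇ b₁ ] (aₘ ∷ 0₇ ∷ [ b₁ ]) (bmid ++ bₗ ∷ 0₇ ∷ a₁ ∷ amid)
      (trans (Mn-insert-0 b₁ aₘ) (cong (λ z → -Id ⊗ Mn [ z ]) (+₇-comm b₁ aₘ)))
      (IsSolution-rotate (bₗ ∷ 0₇ ∷ a₁ ∷ amid) ((aₘ +₇ b₁) ∷ bmid) first-split)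

  b-then-0-a-0 : IsSolution (tup b₁ bmid bₗ ++ 0₇ ∷ a₁ ∷ amid ++ aₘ ∷ [ 0₇ ])
  b-then-0-a-0 =
    subst IsSolution
      (cong (b₁ ∷_) (trans (++-assoc bmid (bₗ ∷ 0₇ ∷ a₁ ∷ amid) (aₘ ∷ [ 0₇ ]))
                           (sym (++-assoc bmid [ bₗ ] (0₇ ∷ a₁ ∷ amid ++ aₘ ∷ [ 0₇ ])))))
      (IsSolution-rotate (aₘ ∷ [ 0₇ ]) (b₁ ∷ bmid ++ bₗ ∷ 0₇ ∷ a₁ ∷ amid) second-split)

  0-a-0 : IsSolution ((0₇ ∷ tup a₁ amid aₘ) ++ [ 0₇ ])
  0-a-0 =
    subst IsSolution (cong (λ z → 0₇ ∷ a₁ ∷ z) (sym (++-assoc amid [ aₘ ] [ 0₇ ])))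
      (IsSolution-cancelˡ (tup b₁ bmid bₗ) (0₇ ∷ a₁ ∷ amid ++ aₘ ∷ [ 0₇ ]) b-then-0-a-0 b)

Is±1 : Z7 → Set
Is±1 x = x ≡ 1₇ ⊎ x ≡ -₇ 1₇

is±1? : Decidable Is±1
is±1? x = (x ≟ 1₇) ⊎-dec (x ≟ -₇ 1₇)

Extendable : List Z7 → Set
Extendable w = ∃₂ λ b₁ bₗ → IsSolution (tup b₁ w bₗ)

extendable⇒m11-±1 : ∀ w → Extendable w → Is±1 (Mat.m11 (Mn w))
extendable⇒m11-±1 w (b₁ , bₗ , sol) = m22⇒m11 (Mn w) (m22-±1 (subst Is±Id (Mn-tup b₁ w bₗ) sol))
  where
  m22-±1 : ∀ {X} → Is±Id X → Is±1 (Mat.m22 X)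
  m22-±1 (inj₁ refl) = inj₁ refl
  m22-±1 (inj₂ refl) = inj₂ refl

  -- The (2,2) entry of M(bₗ) P M(b₁) is -p₁₁ and involves neither b₁ nor bₗ, so checking
  -- the case b₁ = bₗ = 0 is a proof for all of them.
  m22⇒m11 : ∀ P → Is±1 (Mat.m22 (Mᵃ bₗ ⊗ (P ⊗ Mᵃ b₁))) → Is±1 (Mat.m11 P)
  m22⇒m11 = from-yes (all-mat? λ P → is±1? (Mat.m22 (Mᵃ 0₇ ⊗ (P ⊗ Mᵃ 0₇))) →-dec is±1? (Mat.m11 P))

-- With P = (p q; r s), the off-diagonal entries of M(bₗ) P M(b₁) are r - bₗ p and b₁ p + q;
-- as p = ±1 is its own inverse they vanish for bₗ = r p and b₁ = -(q p), and then det P = 1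
-- makes the diagonal ±Id.
m11-±1⇒extendable : ∀ w → Is±1 (Mat.m11 (Mn w)) → Extendable w
m11-±1⇒extendable w m11-±1 =
  b₁ (Mn w) , bₗ (Mn w) ,
  subst Is±Id (sym (Mn-tup (b₁ (Mn w)) w (bₗ (Mn w)))) (completion (Mn w) (det-Mn w) m11-±1)
  where
  b₁ bₗ : Mat → Z7
  b₁ (mat p q r s) = -₇ (q *₇ p)
  bₗ (mat p q r s) = r *₇ p

  completion : ∀ P → det P ≡ 1₇ → Is±1 (Mat.m11 P) → Is±Id (Mᵃ (bₗ P) ⊗ (P ⊗ Mᵃ (b₁ P)))
  completion = from-yes (all-mat? λ P →
    (det P ≟ 1₇) →-dec is±1? (Mat.m11 P) →-dec is±Id? (Mᵃ (bₗ P) ⊗ (P ⊗ Mᵃ (b₁ P))))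

extendable? : Decidable Extendable
extendable? w = map′ (m11-±1⇒extendable w) (extendable⇒m11-±1 w) (is±1? (Mat.m11 (Mn w)))

drop-length-++ : ∀ {A : Set} (xs ys : List A) → drop (length xs) (xs ++ ys) ≡ ys
drop-length-++ [] ys = refl
drop-length-++ (x ∷ xs) ys = drop-length-++ xs ys

take-length-++ : ∀ {A : Set} (xs ys : List A) → take (length xs) (xs ++ ys) ≡ xs
take-length-++ [] ys = refl
take-length-++ (x ∷ xs) ys = cong (x ∷_) (take-length-++ xs ys)

rotate-length-++ : ∀ xs ys → rotate (length xs) (xs ++ ys) ≡ ys ++ xs
rotate-length-++ xs ys = cong₂ _++_ (drop-length-++ xs ys) (take-length-++ xs ys)

rotate-inverse : ∀ k xs → rotate (length (drop k xs)) (rotate k xs) ≡ xs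
rotate-inverse k xs = trans (rotate-length-++ (drop k xs) (take k xs)) (take++drop≡id k xs)

length-rotate : ∀ k xs → length (rotate k xs) ≡ length xs
length-rotate k xs = trans (length-++-comm (drop k xs) (take k xs)) (cong length (take++drop≡id k xs))

rotate-bounded : ∀ k xs → ∃ λ (j : Fin (suc (length xs))) → rotate k xs ≡ rotate (toℕ j) xs
rotate-bounded k xs with k ≤? length xs
... | yes k≤ = fromℕ< (s≤s k≤) , cong (λ i → rotate i xs) (sym (toℕ-fromℕ< (s≤s k≤)))
... | no k≰ = zero , trans (cong₂ _++_ (drop-all k xs k≥) (take-all k xs k≥)) (sym (++-identityʳ xs))
  where k≥ = <⇒≤ (≰⇒> k≰)

IsCyclicPerm-inverse : ∀ {c d} → IsCyclicPerm c d → ∃ λ (j : Fin (suc (length c))) → d ≡ rotate (toℕ j) c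
IsCyclicPerm-inverse {d = d} (k , refl) =
  fromℕ< (s≤s j≤) ,
  trans (sym (rotate-inverse k d)) (cong (λ i → rotate i (rotate k d)) (sym (toℕ-fromℕ< (s≤s j≤))))
  where
  j≤ : length (drop k d) ≤ length (rotate k d)
  j≤ = subst₂ _≤_ (sym (length-drop k d)) (sym (length-rotate k d)) (m∸n≤m (length d) k)

∼-inverse : ∀ {c e} → c ∼ e →
  ∃ λ (j : Fin (suc (length c))) → e ≡ rotate (toℕ j) c ⊎ e ≡ reverse (rotate (toℕ j) c)
∼-inverse (inj₁ perm) = let j , e≡ = IsCyclicPerm-inverse perm in j , inj₁ e≡
∼-inverse {e = e} (inj₂ perm) =
  let j , rev≡ = IsCyclicPerm-inverse perm in j , inj₂ (trans (sym (reverse-involutive e)) (cong reverse rev≡))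

split-reducible : ∀ r w → IsSolution (r ++ w) → 3 ≤ length r → 1 ≤ length w → Extendable w →
  ∀ {c} → IsCyclicPerm c (r ++ w) → Reducible c
split-reducible (x ∷ r) w sol r≥3 w≥1 ext perm with initLast r
split-reducible (x ∷ _) w sol (s≤s ()) w≥1 ext perm | []
split-reducible (x ∷ _) w sol (s≤s (s≤s ())) w≥1 ext perm | [] ∷ʳ′ y
split-reducible (x ∷ _) w sol r≥3 w≥1 (b₁ , bₗ , b-sol) (k , c≡) | (a ∷ amid) ∷ʳ′ y =
  x′ , a ∷ amid , y′ , b₁ , w , bₗ ,
  IsSolution-⊕-cancelʳ x′ (a ∷ amid) y′ b₁ w bₗ (subst IsSolution r++w≡⊕ sol) b-sol ,
  s≤s z≤n , b-sol , w≥1 , inj₁ (k , trans c≡ (cong (rotate k) r++w≡⊕))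
  where
  x′ = x +₇ (-₇ bₗ)
  y′ = y +₇ (-₇ b₁)
  r++w≡⊕ : (x ∷ (a ∷ amid) ∷ʳ y) ++ w ≡ ⊕ x′ (a ∷ amid) y′ b₁ w bₗ
  r++w≡⊕ = begin
    x ∷ ((a ∷ amid ++ [ y ]) ++ w) ≡⟨ cong (x ∷_) (++-assoc (a ∷ amid) [ y ] w) ⟩
    x ∷ a ∷ amid ++ y ∷ w          ≡⟨ cong₂ (λ u v → u ∷ a ∷ amid ++ v ∷ w) (sym (x-y+y≡x x bₗ)) (sym (x-y+y≡x y b₁)) ⟩
    ⊕ x′ (a ∷ amid) y′ b₁ w bₗ     ∎

infix-reducible : ∀ pre w B → IsSolution ((pre ++ w) ++ B) → 3 ≤ length (B ++ pre) → 1 ≤ length w →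
  Extendable w → Reducible ((pre ++ w) ++ B)
infix-reducible pre w B sol complement≥3 w≥1 ext =
  split-reducible (B ++ pre) w rotated-sol complement≥3 w≥1 ext (length B , rotation)
  where
  B++pre++w : B ++ (pre ++ w) ≡ (B ++ pre) ++ w
  B++pre++w = sym (++-assoc B pre w)
  rotated-sol : IsSolution ((B ++ pre) ++ w)
  rotated-sol = subst IsSolution B++pre++w (IsSolution-rotate (pre ++ w) B sol)
  rotation : (pre ++ w) ++ B ≡ rotate (length B) ((B ++ pre) ++ w)
  rotation = trans (sym (rotate-length-++ B (pre ++ w))) (cong (rotate (length B)) B++pre++w)

ExtendableTail : List Z7 → Set
ExtendableTail e = ∃ λ (i : Fin (length e)) → 3 ≤ toℕ i × Extendable (drop (toℕ i) e)

extendableTail? : Decidable ExtendableTail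
extendableTail? e = any? λ i → (3 ≤? toℕ i) ×-dec extendable? (drop (toℕ i) e)

extendableTail-++ : ∀ r w → 3 ≤ length r → 1 ≤ length w → Extendable w → ExtendableTail (r ++ w)
extendableTail-++ r w r≥3 w≥1 ext =
  fromℕ< r<r++w ,
  subst (3 ≤_) (sym i≡) r≥3 ,
  subst Extendable (sym (trans (cong (λ i → drop i (r ++ w)) i≡) (drop-length-++ r w))) ext
  where
  r<r++w : length r < length (r ++ w)
  r<r++w = subst (length r <_) (sym (length-++ r)) (m<m+n (length r) w≥1)
  i≡ = toℕ-fromℕ< r<r++w

reducible⇒extendableTail : ∀ {c} → Reducible c → ∃ λ e → c ∼ e × ExtendableTail e
reducible⇒extendableTail (a₁ , amid , aₘ , b₁ , bmid , bₗ , _ , amid≥1 , b-sol , bmid≥1 , c∼e) =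
  ⊕ a₁ amid aₘ b₁ bmid bₗ , c∼e ,
  subst ExtendableTail (cong (a₁ +₇ bₗ ∷_) (++-assoc amid [ aₘ +₇ b₁ ] bmid))
    (extendableTail-++ ((a₁ +₇ bₗ) ∷ amid ∷ʳ (aₘ +₇ b₁)) bmid
       (s≤s (subst (2 ≤_) (sym (length-++ amid)) (+-monoˡ-≤ 1 amid≥1))) bmid≥1 (b₁ , bₗ , b-sol))

NoExtendableTail : List Z7 → Set
NoExtendableTail c = ∀ (j : Fin (suc (length c))) →
  ¬ ExtendableTail (rotate (toℕ j) c) × ¬ ExtendableTail (reverse (rotate (toℕ j) c))

Certified : List Z7 → Set
Certified c = IsSolution c × 3 ≤ length c × NoExtendableTail c

noExtendableTail? : Decidable NoExtendableTail
noExtendableTail? c =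
  all? λ j → ¬? (extendableTail? (rotate (toℕ j) c)) ×-dec ¬? (extendableTail? (reverse (rotate (toℕ j) c)))

certified? : Decidable Certified
certified? c = is±Id? (Mn c) ×-dec (3 ≤? length c) ×-dec noExtendableTail? c

certified⇒irreducible : ∀ {c} → Certified c → Irreducible c
certified⇒irreducible {c} (sol , c≥3 , none) = sol , c≥3 , not-reducible
  where
  not-reducible : ¬ Reducible c
  not-reducible red with reducible⇒extendableTail red
  ... | e , c∼e , tail with ∼-inverse c∼e
  ... | j , inj₁ refl = proj₁ (none j) tail
  ... | j , inj₂ refl = proj₂ (none j) tail

PrefixWindowFree : ℕ → List Z7 → Set
PrefixWindowFree K l = ∀ (j : Fin K) → ¬ Extendable (take (suc (toℕ j)) l)

prefixWindowFree? : ∀ K → Decidable (PrefixWindowFree K)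
prefixWindowFree? K l = all? λ j → ¬? (extendable? (take (suc (toℕ j)) l))

WindowFree : ℕ → List Z7 → Set
WindowFree K []      = ⊤
WindowFree K (x ∷ l) = PrefixWindowFree K (x ∷ l) × WindowFree K l

WindowFree-drop : ∀ K i c → WindowFree K c → WindowFree K (drop i c)
WindowFree-drop K zero c free = free
WindowFree-drop K (suc i) [] free = tt
WindowFree-drop K (suc i) (x ∷ c) (_ , free) = WindowFree-drop K i c free

irreducible⇒windowFree : ∀ K {c} → Irreducible c → K + 3 ≤ length c → WindowFree K c
irreducible⇒windowFree K {c} (sol , _ , irreducible) c≥K+3 = suffix [] c refl
  where
  suffix : ∀ pre l → c ≡ pre ++ l → WindowFree K l
  suffix pre [] _ = tt
  suffix pre (x ∷ l) c≡ = prefix-free , suffix (pre ++ [ x ]) l (trans c≡ (sym (++-assoc pre [ x ] l)))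
    where
    prefix-free : PrefixWindowFree K (x ∷ l)
    prefix-free j ext =
      irreducible (subst Reducible (sym c≡pre++w++B)
        (infix-reducible pre w B (subst IsSolution c≡pre++w++B sol) complement≥3 (s≤s z≤n) ext))
      where
      w = take (suc (toℕ j)) (x ∷ l)
      B = drop (suc (toℕ j)) (x ∷ l)
      c≡pre++w++B : c ≡ (pre ++ w) ++ B
      c≡pre++w++B =
        trans c≡ (trans (cong (pre ++_) (sym (take++drop≡id (suc (toℕ j)) (x ∷ l)))) (sym (++-assoc pre w B)))
      w≤K : length w ≤ K
      w≤K = ≤-trans (≤-reflexive (length-take (suc (toℕ j)) (x ∷ l))) (≤-trans (m⊓n≤m _ _) (toℕ<n j))
      length-c : length c ≡ length (B ++ pre) + length w
      length-c = begin
        length c                      ≡⟨ cong length c≡pre++w++B ⟩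
        length ((pre ++ w) ++ B)      ≡⟨ length-++-comm (pre ++ w) B ⟩
        length (B ++ pre ++ w)        ≡⟨ cong length (sym (++-assoc B pre w)) ⟩
        length ((B ++ pre) ++ w)      ≡⟨ length-++ (B ++ pre) ⟩
        length (B ++ pre) + length w  ∎
      complement≥3 : 3 ≤ length (B ++ pre)
      complement≥3 = +-cancelˡ-≤ K 3 (length (B ++ pre))
        (≤-trans (subst (K + 3 ≤_) length-c c≥K+3)
          (≤-trans (+-monoʳ-≤ (length (B ++ pre)) w≤K) (≤-reflexive (+-comm (length (B ++ pre)) K))))

extensions : ℕ → List Z7 → List (List Z7)
extensions K l = filter (prefixWindowFree? K) (map (_∷ l) (allFin 7))

candidates : ℕ → ℕ → List (List Z7)
candidates K zero    = [ [] ]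
candidates K (suc n) = concatMap (extensions K) (candidates K n)

∈-candidates : ∀ K c → WindowFree K c → c ∈ candidates K (length c)
∈-candidates K [] _ = here refl
∈-candidates K (x ∷ c) (prefix-free , free) = ∈-concatMap⁺ (extensions K) (Any.map x∷c∈ (∈-candidates K c free))
  where
  x∷c∈ : ∀ {l} → c ≡ l → x ∷ c ∈ extensions K l
  x∷c∈ refl = ∈-filter⁺ (prefixWindowFree? K) (∈-map⁺ (_∷ c) (∈-allFin x)) prefix-free

candidates-7-8≡[] : candidates 7 8 ≡ []
candidates-7-8≡[] = refl

InTable : List Z7 → Set
InTable d = Any (λ t → ∃ λ (k : Fin (length t)) → d ≡ rotate (toℕ k) (toZ7 t)) table

inTable? : Decidable InTable
inTable? d = Any.any? (λ t → any? λ k → ≡-dec _≟_ d (rotate (toℕ k) (toZ7 t))) table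

solutionsInTable? : ∀ n → Dec (All (λ d → IsSolution d → InTable d) (candidates (n ∸ 3) n))
solutionsInTable? n = All.all? (λ d → is±Id? (Mn d) →-dec inTable? d) (candidates (n ∸ 3) n)

small-solutions-in-table : ∀ n → 3 ≤ n → n < 10 → All (λ d → IsSolution d → InTable d) (candidates (n ∸ 3) n)
small-solutions-in-table 1 (s≤s ()) _
small-solutions-in-table 2 (s≤s (s≤s ())) _
small-solutions-in-table 3 _ _ = from-yes (solutionsInTable? 3)
small-solutions-in-table 4 _ _ = from-yes (solutionsInTable? 4)
small-solutions-in-table 5 _ _ = from-yes (solutionsInTable? 5)
small-solutions-in-table 6 _ _ = from-yes (solutionsInTable? 6)
small-solutions-in-table 7 _ _ = from-yes (solutionsInTable? 7)
small-solutions-in-table 8 _ _ = from-yes (solutionsInTable? 8)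
small-solutions-in-table 9 _ _ = from-yes (solutionsInTable? 9)
small-solutions-in-table (suc (suc (suc (suc (suc (suc (suc (suc (suc (suc _)))))))))) _
  (s≤s (s≤s (s≤s (s≤s (s≤s (s≤s (s≤s (s≤s (s≤s (s≤s ()))))))))))

RotationsCertified : List Z7 → Set
RotationsCertified xs = ∀ (k : Fin (suc (length xs))) → Certified (rotate (toℕ k) xs)

rotationsCertified? : Decidable RotationsCertified
rotationsCertified? xs = all? λ k → certified? (rotate (toℕ k) xs)

table-certified : All (λ t → RotationsCertified (toZ7 t)) table
table-certified = from-yes (All.all? (λ t → rotationsCertified? (toZ7 t)) table)

length-bound : ∀ c → Irreducible c → length c < 10
length-bound c irr with 10 ≤? length c
... | no c≱10 = ≰⇒> c≱10
... | yes c≥10 = ⊥-elim (¬Any[] (subst (suffix ∈_) candidates-7-8≡[] suffix∈))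
  where
  suffix = drop (length c ∸ 8) c
  suffix≡8 : length suffix ≡ 8
  suffix≡8 = trans (length-drop (length c ∸ 8) c) (m∸[m∸n]≡n (≤-trans (m≤m+n 8 2) c≥10))
  suffix∈ : suffix ∈ candidates 7 8
  suffix∈ = subst (λ n → suffix ∈ candidates 7 n) suffix≡8
    (∈-candidates 7 suffix (WindowFree-drop 7 (length c ∸ 8) c (irreducible⇒windowFree 7 irr c≥10)))

irreducible⇒inTable : ∀ {c} → Irreducible c → ∃ λ t → t ∈ table × IsCyclicPerm c (toZ7 t)
irreducible⇒inTable {c} irr@(sol , c≥3 , _) =
  let t , t∈ , k , c≡ = find (All.lookup (small-solutions-in-table n c≥3 (length-bound c irr)) c∈ sol)
  in t , t∈ , toℕ k , c≡
  where
  n = length c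
  c∈ : c ∈ candidates (n ∸ 3) n
  c∈ = ∈-candidates (n ∸ 3) c (irreducible⇒windowFree (n ∸ 3) irr (≤-reflexive (m∸n+n≡m c≥3)))

inTable⇒irreducible : ∀ {c t} → t ∈ table → IsCyclicPerm c (toZ7 t) → Irreducible c
inTable⇒irreducible {t = t} t∈ (k , refl) =
  let j , rotation≡ = rotate-bounded k (toZ7 t)
  in subst Irreducible (sym rotation≡) (certified⇒irreducible (All.lookup table-certified t∈ j))

mainTheorem6 : ((c : List Z7) →
                   Irreducible c ⇔ (∃ λ t → t ∈ table × IsCyclicPerm c (toZ7 t)))
                 × ((c : List Z7) → Irreducible c → length c < 10)
mainTheorem6 =
  (λ c → mk⇔ irreducible⇒inTable (λ (t , t∈ , perm) → inTable⇒irreducible t∈ perm)) , length-bound
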